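{- Let $(\mathcal{C},\otimes,I)$ be a symmetric monoidal category with finite products which has the free exponential, equipped with a reciprocal orthogonality relative to an object $J$. Let $\mathbf{A}=(A,\mathbf{A}_p)$ and $\mathbf{B}=(B,\mathbf{B}_p)$ be objects of $T_J(\mathcal{C})$. Then $(\mathbf{A}^{\le\infty}\otimes\mathbf{B},(p_{\infty,n}\otimes B)_n)$ is a limit in $T_J(\mathcal{C})$ of the diagram $(p_{n+1,n}\otimes\mathbf{B}:\mathbf{A}^{\le n+1}\otimes\mathbf{B}\to\mathbf{A}^{\le n}\otimes\mathbf{B})_n$ if and only if $$\big((\mathbf{A}^{\le\infty})_p\otimes\mathbf{B}_p\big)^{\circ\circ}=\bigcap_{n\in\mathbb{N}}\Big\{u\in\mathcal{C}(I,A^{\le\infty}\otimes B):(p_{\infty,n}\otimes B)\circ u\in\big((\mathbf{A}^{\le n})_p\otimes\mathbf{B}_p\big)^{\circ\circ}\Big\}.$$ Moreover this equation holds whenever $\mathbf{B}=\mathbf{I}$ (identifying $X\otimes I$ with $X$).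
   Context: Free exponential (Melliès–Tabareau–Tasson): for every object $A$, with $A_\bullet=A\& I$ and projections $\mathsf{p}_l,\mathsf{p}_r$: (E) the $n!$ symmetries of $A_\bullet^{\otimes n}$ have an equaliser $\mathsf{eq}_A:A^{\le n}\to A_\bullet^{\otimes n}$ for each $n$; (E$\otimes$) $\mathsf{eq}_A\otimes B$ is an equaliser of the $\sigma\otimes B$ for every $B$; (L) with $p_{n+1,n}$ the unique morphism such that $\mathsf{eq}_A\circ p_{n+1,n}=(A_\bullet^{\otimes n}\otimes\mathsf{p}_r)\circ\mathsf{eq}_A$, the diagram $A^{\le 0}\leftarrow A^{\le1}\leftarrow\cdots$ has a limit $A^{\le\infty}$ with projections $p_{\infty,n}$; (L$\otimes$) for every $B$, $(A^{\le\infty}\otimes B,(p_{\infty,n}\otimes B)_n)$ is a limit of $(p_{n+1,n}\otimes B)_n$ in $\mathcal{C}$. A reciprocal orthogonality relative to $J$: relations $\perp_R\subseteq\mathcal{C}(I,R)\times\mathcal{C}(R,J)$ with $u\perp_R x\circ f$ iff $f\circ u\perp_Sx$. Orthogonals: $U^\circ=\{x:\forall u\in U,\ u\perp x\}$, $X^\circ=\{u:\forall x\in X,\ u\perp x\}$; $u\otimes v$ is $I\cong I\otimes I\to R\otimes S$, $U\otimes V=\{u\otimes v\}$. $T_J(\mathcal{C})$: objects $(A,\mathbf{A}_p)$ with $\mathbf{A}_p\subseteq\mathcal{C}(I,A)$, $\mathbf{A}_p^{\circ\circ}=\mathbf{A}_p$; morphisms $f:A\to B$ with $f\circ u\in\mathbf{B}_p$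 for $u\in\mathbf{A}_p$; $\mathbf{A}\&\mathbf{B}=(A\& B,\{\langle u,v\rangle\})$, $\mathbf{A}\otimes\mathbf{B}=(A\otimes B,(\mathbf{A}_p\otimes\mathbf{B}_p)^{\circ\circ})$, $\mathbf{I}=(I,\{\mathrm{id}_I\}^{\circ\circ})$. $(\mathbf{A}^{\le n})_p=\{\mathsf{eq}_A\backslash h:h\in((\mathbf{A}\&\mathbf{I})^{\otimes n})_p\text{ equalising the symmetries}\}^{\circ\circ}$ ($\mathsf{eq}_A\backslash h$ the unique factorisation of $h$ through $\mathsf{eq}_A$), $\mathbf{A}^{\le n}=(A^{\le n},(\mathbf{A}^{\le n})_p)$; $(\mathbf{A}^{\le\infty})_p=\{x\in\mathcal{C}(I,A^{\le\infty}):\forall n,\ p_{\infty,n}\circ x\in(\mathbf{A}^{\le n})_p\}^{\circ\circ}$, $\mathbf{A}^{\le\infty}=(A^{\le\infty},(\mathbf{A}^{\le\infty})_p)$. -}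

module Defs where

open import Level using (Level; _⊔_) renaming (suc to lsuc)
open import Data.Nat using (ℕ; zero; suc)
open import Data.Product using (Σ; _×_; _,_)
open import Relation.Binary.PropositionalEquality using (_≡_)

_⟺_ : ∀ {a b} → Set a → Set b → Set (a ⊔ b)
P ⟺ Q = (P → Q) × (Q → P)

record Category (o ℓ : Level) : Set (lsuc (o ⊔ ℓ)) where
  infixr 9 _∘_
  field
    Obj : Set o
    Hom : Obj → Obj → Set ℓ
    id  : ∀ {A} → Hom A A
    _∘_ : ∀ {A B C} → Hom B C → Hom A B → Hom A C
    assoc : ∀ {A B C D} {f : Hom A B} {g : Hom B C} {h : Hom C D} →
            (h ∘ g) ∘ f ≡ h ∘ (g ∘ f)
    identityˡ : ∀ {A B} {f : Hom A B} → id ∘ f ≡ f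
    identityʳ : ∀ {A B} {f : Hom A B} → f ∘ id ≡ f

module _ {o ℓ : Level} (𝒞 : Category o ℓ) where
  open Category 𝒞

  record SymmetricMonoidal : Set (o ⊔ ℓ) where
    infixr 10 _⊗₀_ _⊗₁_
    field
      _⊗₀_ : Obj → Obj → Obj
      _⊗₁_ : ∀ {A B C D} → Hom A B → Hom C D → Hom (A ⊗₀ C) (B ⊗₀ D)
      ⊗-id : ∀ {A B} → id {A} ⊗₁ id {B} ≡ id
      ⊗-∘ : ∀ {A B C D E F} {f : Hom A B} {g : Hom B C} {h : Hom D E} {k : Hom E F} →
            (g ∘ f) ⊗₁ (k ∘ h) ≡ (g ⊗₁ k) ∘ (f ⊗₁ h)
      unit : Obj
      α⇒ : ∀ {X Y Z} → Hom ((X ⊗₀ Y) ⊗₀ Z) (X ⊗₀ (Y ⊗₀ Z))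
      α⇐ : ∀ {X Y Z} → Hom (X ⊗₀ (Y ⊗₀ Z)) ((X ⊗₀ Y) ⊗₀ Z)
      α-iso₁ : ∀ {X Y Z} → α⇒ {X} {Y} {Z} ∘ α⇐ ≡ id
      α-iso₂ : ∀ {X Y Z} → α⇐ {X} {Y} {Z} ∘ α⇒ ≡ id
      α-natural : ∀ {X X' Y Y' Z Z'} {f : Hom X X'} {g : Hom Y Y'} {h : Hom Z Z'} →
                  α⇒ ∘ ((f ⊗₁ g) ⊗₁ h) ≡ (f ⊗₁ (g ⊗₁ h)) ∘ α⇒
      λ⇒ : ∀ {X} → Hom (unit ⊗₀ X) X
      λ⇐ : ∀ {X} → Hom X (unit ⊗₀ X)
      λ-iso₁ : ∀ {X} → λ⇒ {X} ∘ λ⇐ ≡ id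
      λ-iso₂ : ∀ {X} → λ⇐ {X} ∘ λ⇒ ≡ id
      λ-natural : ∀ {X Y} {f : Hom X Y} → λ⇒ ∘ (id ⊗₁ f) ≡ f ∘ λ⇒
      ρ⇒ : ∀ {X} → Hom (X ⊗₀ unit) X
      ρ⇐ : ∀ {X} → Hom X (X ⊗₀ unit)
      ρ-iso₁ : ∀ {X} → ρ⇒ {X} ∘ ρ⇐ ≡ id
      ρ-iso₂ : ∀ {X} → ρ⇐ {X} ∘ ρ⇒ ≡ id
      ρ-natural : ∀ {X Y} {f : Hom X Y} → ρ⇒ ∘ (f ⊗₁ id) ≡ f ∘ ρ⇒
      σ⇒ : ∀ {X Y} → Hom (X ⊗₀ Y) (Y ⊗₀ X)
      σ-natural : ∀ {X X' Y Y'} {f : Hom X X'} {g : Hom Y Y'} →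
                  σ⇒ ∘ (f ⊗₁ g) ≡ (g ⊗₁ f) ∘ σ⇒
      σ-involutive : ∀ {X Y} → σ⇒ {Y} {X} ∘ σ⇒ {X} {Y} ≡ id
      pentagon : ∀ {W X Y Z} →
                 α⇒ {W} {X} {Y ⊗₀ Z} ∘ α⇒ {W ⊗₀ X} {Y} {Z}
                 ≡ (id ⊗₁ α⇒) ∘ (α⇒ ∘ (α⇒ ⊗₁ id))
      triangle : ∀ {X Y} → (id {X} ⊗₁ λ⇒ {Y}) ∘ α⇒ ≡ ρ⇒ ⊗₁ id
      hexagon : ∀ {X Y Z} →
                α⇒ {Y} {Z} {X} ∘ (σ⇒ {X} {Y ⊗₀ Z} ∘ α⇒)
                ≡ (id ⊗₁ σ⇒) ∘ (α⇒ ∘ (σ⇒ ⊗₁ id))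

  record FiniteProducts : Set (o ⊔ ℓ) where
    infixr 8 _&_
    field
      ⊤ : Obj
      ! : ∀ {A} → Hom A ⊤
      !-unique : ∀ {A} (f : Hom A ⊤) → f ≡ !
      _&_ : Obj → Obj → Obj
      π₁ : ∀ {A B} → Hom (A & B) A
      π₂ : ∀ {A B} → Hom (A & B) B
      ⟨_,_⟩ : ∀ {C A B} → Hom C A → Hom C B → Hom C (A & B)
      β₁ : ∀ {C A B} {f : Hom C A} {g : Hom C B} → π₁ ∘ ⟨ f , g ⟩ ≡ f
      β₂ : ∀ {C A B} {f : Hom C A} {g : Hom C B} → π₂ ∘ ⟨ f , g ⟩ ≡ g
      η-unique : ∀ {C A B} {f : Hom C A} {g : Hom C B} {h : Hom C (A & B)} →
                 π₁ ∘ h ≡ f → π₂ ∘ h ≡ g → h ≡ ⟨ f , g ⟩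

  record IsEqualiser {X Y E : Obj} (S : Hom X Y → Set ℓ) (e : Hom E X) : Set (o ⊔ ℓ) where
    field
      equalises : ∀ s t → S s → S t → s ∘ e ≡ t ∘ e
      universal : ∀ {Z} (h : Hom Z X) → (∀ s t → S s → S t → s ∘ h ≡ t ∘ h) →
                  Σ (Hom Z E) λ k → (e ∘ k ≡ h) × (∀ k' → e ∘ k' ≡ h → k' ≡ k)

  record IsChainLimit (D : ℕ → Obj) (d : ∀ n → Hom (D (suc n)) (D n))
                      {L : Obj} (π : ∀ n → Hom L (D n)) : Set (o ⊔ ℓ) where
    field
      cone : ∀ n → d n ∘ π (suc n) ≡ π n
      universal : ∀ {Z} (c : ∀ n → Hom Z (D n)) → (∀ n → d n ∘ c (suc n) ≡ c n) →
                  Σ (Hom Z L) λ k → (∀ n → π n ∘ k ≡ c n) ×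
                    (∀ k' → (∀ n → π n ∘ k' ≡ c n) → k' ≡ k)

  module _ (M : SymmetricMonoidal) where
    open SymmetricMonoidal M

    _^⊗_ : Obj → ℕ → Obj
    X ^⊗ zero = unit
    X ^⊗ suc n = (X ^⊗ n) ⊗₀ X

    data Transposition (X : Obj) : (n : ℕ) → Hom (X ^⊗ n) (X ^⊗ n) → Set ℓ where
      top  : ∀ {n} → Transposition X (suc (suc n))
                       (α⇐ ∘ ((id ⊗₁ σ⇒) ∘ α⇒))
      lift : ∀ {n f} → Transposition X n f → Transposition X (suc n) (f ⊗₁ id)

    -- the symmetries of X^{⊗n}: the morphisms induced by permutations of the
    -- n factors, i.e. composites of adjacent transpositions
    data Symmetry (X : Obj) (n : ℕ) : Hom (X ^⊗ n) (X ^⊗ n) → Set ℓ where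
      sym-id   : Symmetry X n id
      sym-step : ∀ {t f} → Transposition X n t → Symmetry X n f → Symmetry X n (t ∘ f)

    SymmetryTensor : (X : Obj) (n : ℕ) (B : Obj) → Hom ((X ^⊗ n) ⊗₀ B) ((X ^⊗ n) ⊗₀ B) → Set ℓ
    SymmetryTensor X n B g = Σ (Hom (X ^⊗ n) (X ^⊗ n)) λ s → Symmetry X n s × (g ≡ s ⊗₁ id {B})

    module _ (P : FiniteProducts) where
      open FiniteProducts P

      _• : Obj → Obj
      A • = A & unit

      -- the free exponential (conditions (E), (E⊗), (L), (L⊗))
      record FreeExponential : Set (o ⊔ ℓ) where
        field
          Exp : Obj → ℕ → Obj
          eq  : ∀ A n → Hom (Exp A n) ((A •) ^⊗ n)
          eq-equaliser : ∀ A n → IsEqualiser (Symmetry (A •) n) (eq A n)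
          eq-equaliser-⊗ : ∀ A n B →
            IsEqualiser (SymmetryTensor (A •) n B) (eq A n ⊗₁ id {B})
          -- p_{n+1,n}: eq ∘ p = (A•^{⊗n} ⊗ p_r) ∘ eq  (with A•^{⊗n} ⊗ I ≅ A•^{⊗n})
          p : ∀ A n → Hom (Exp A (suc n)) (Exp A n)
          p-spec : ∀ A n → eq A n ∘ p A n ≡ ρ⇒ ∘ ((id ⊗₁ π₂) ∘ eq A (suc n))
          Exp∞ : Obj → Obj
          p∞ : ∀ A n → Hom (Exp∞ A) (Exp A n)
          limit : ∀ A → IsChainLimit (Exp A) (p A) (p∞ A)
          limit-⊗ : ∀ A B → IsChainLimit (λ n → Exp A n ⊗₀ B)
                                         (λ n → p A n ⊗₁ id {B})
                                         (λ n → p∞ A n ⊗₁ id {B})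

      record ReciprocalOrthogonality (J : Obj) : Set (o ⊔ lsuc ℓ) where
        field
          _⊥_ : ∀ {R} → Hom unit R → Hom R J → Set ℓ
          reciprocal : ∀ {R S} (u : Hom unit R) (f : Hom R S) (x : Hom S J) →
                       (u ⊥ (x ∘ f)) ⟺ ((f ∘ u) ⊥ x)

      module Theory (E : FreeExponential) {J : Obj} (O : ReciprocalOrthogonality J) where
        open FreeExponential E public
        open ReciprocalOrthogonality O public

        Points : Obj → Set (lsuc ℓ)
        Points A = Hom unit A → Set ℓ

        Copoints : Obj → Set (lsuc ℓ)
        Copoints A = Hom A J → Set ℓ

        _° : ∀ {A} → Points A → Copoints A
        (U °) x = ∀ u → U u → u ⊥ x

        _°' : ∀ {A} → Copoints A → Points A
        (X °') u = ∀ x → X x → u ⊥ x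

        _°° : ∀ {A} → Points A → Points A
        U °° = (U °) °'

        _≐_ : ∀ {A} → Points A → Points A → Set ℓ
        U ≐ V = ∀ u → U u ⟺ V u

        _⊗ₚ_ : ∀ {R S} → Hom unit R → Hom unit S → Hom unit (R ⊗₀ S)
        u ⊗ₚ v = (u ⊗₁ v) ∘ λ⇐

        _⊗ₛ_ : ∀ {R S} → Points R → Points S → Points (R ⊗₀ S)
        (U ⊗ₛ V) w = Σ (Hom unit _) λ u → Σ (Hom unit _) λ v → U u × V v × (w ≡ u ⊗ₚ v)

        tensorP : ∀ {R S} → Points R → Points S → Points (R ⊗₀ S)
        tensorP U V = (U ⊗ₛ V) °°

        withP : ∀ {R S} → Points R → Points S → Points (R & S)
        withP U V w = Σ (Hom unit _) λ u → Σ (Hom unit _) λ v → U u × V v × (w ≡ ⟨ u , v ⟩)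

        unitP : Points unit
        unitP = (λ u → u ≡ id) °°

        record TObj : Set (o ⊔ lsuc ℓ) where
          field
            car  : Obj
            pts  : Points car
            closed : (pts °°) ≐ pts
        open TObj public

        IsTMor : ∀ {A B} → Points A → Points B → Hom A B → Set ℓ
        IsTMor U V f = ∀ u → U u → V (f ∘ u)

        powP : ∀ {X} → Points X → (n : ℕ) → Points (X ^⊗ n)
        powP U zero = unitP
        powP U (suc n) = tensorP (powP U n) U

        ExpP : (𝐀 : TObj) (n : ℕ) → Points (Exp (car 𝐀) n)
        ExpP 𝐀 n = (λ w → Σ (Hom unit ((car 𝐀 •) ^⊗ n)) λ h →
                       powP (withP (pts 𝐀) unitP) n h
                     × (∀ s t → Symmetry (car 𝐀 •) n s → Symmetry (car 𝐀 •) n t → s ∘ h ≡ t ∘ h)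
                     × (eq (car 𝐀) n ∘ w ≡ h)) °°

        Exp∞P : (𝐀 : TObj) → Points (Exp∞ (car 𝐀))
        Exp∞P 𝐀 = (λ x → ∀ n → ExpP 𝐀 n (p∞ (car 𝐀) n ∘ x)) °°

        record IsTChainLimit (D : ℕ → Obj) (DP : ∀ n → Points (D n))
                             (d : ∀ n → Hom (D (suc n)) (D n))
                             {L : Obj} (LP : Points L) (π : ∀ n → Hom L (D n))
                             : Set (o ⊔ lsuc ℓ) where
          field
            π-mor : ∀ n → IsTMor LP (DP n) (π n)
            cone  : ∀ n → d n ∘ π (suc n) ≡ π n
            universal : ∀ (Z : TObj) (c : ∀ n → Hom (car Z) (D n)) →
                        (∀ n → IsTMor (pts Z) (DP n) (c n)) →
                        (∀ n → d n ∘ c (suc n) ≡ c n) →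
                        Σ (Hom (car Z) L) λ k → IsTMor (pts Z) LP k
                          × (∀ n → π n ∘ k ≡ c n)
                          × (∀ k' → IsTMor (pts Z) LP k' → (∀ n → π n ∘ k' ≡ c n) → k' ≡ k)

module Submission where

-- Since (L⊗) already gives the limit in 𝒞, only the point-sets are at stake. The points of 𝐈 are
-- the °°-closure of id, and reciprocity makes a map that sends a set of points into a closed set
-- also send its °°-closure there; hence cones out of 𝐈 are exactly the points of the intersection
-- of the preimages, and a T_J-limit must carry exactly that intersection. For 𝐁 = 𝐈 the right unitor
-- identifies (U ⊗ 𝐈_p)°° with U for closed U (this needs ρ_I = λ_I), and an intersection of
-- preimages of closed sets is closed, which gives the equation.

open import Defs
open import Data.Nat using (ℕ; suc)
open import Data.Product using (_×_; _,_; proj₁; proj₂)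
open import Relation.Binary.PropositionalEquality
  using (_≡_; refl; sym; trans; cong; cong₂; subst; module ≡-Reasoning)

module MonoidalCoherence {o ℓ} (𝒞 : Category o ℓ) (M : SymmetricMonoidal 𝒞) where
  open Category 𝒞
  open SymmetricMonoidal M
  open ≡-Reasoning

  cancelʳ : ∀ {A B C} {f h : Hom B C} {g : Hom A B} {g' : Hom B A} →
            g ∘ g' ≡ id → f ∘ g ≡ h ∘ g → f ≡ h
  cancelʳ {f = f} {h} {g} {g'} inv e = begin
    f              ≡⟨ sym identityʳ ⟩
    f ∘ id         ≡⟨ cong (f ∘_) (sym inv) ⟩
    f ∘ (g ∘ g')   ≡⟨ sym assoc ⟩
    (f ∘ g) ∘ g'   ≡⟨ cong (_∘ g') e ⟩
    (h ∘ g) ∘ g'   ≡⟨ assoc ⟩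
    h ∘ (g ∘ g')   ≡⟨ cong (h ∘_) inv ⟩
    h ∘ id         ≡⟨ identityʳ ⟩
    h              ∎

  cancelˡ : ∀ {A B C} {f h : Hom A B} {g : Hom B C} {g' : Hom C B} →
            g' ∘ g ≡ id → g ∘ f ≡ g ∘ h → f ≡ h
  cancelˡ {f = f} {h} {g} {g'} inv e = begin
    f              ≡⟨ sym identityˡ ⟩
    id ∘ f         ≡⟨ cong (_∘ f) (sym inv) ⟩
    (g' ∘ g) ∘ f   ≡⟨ assoc ⟩
    g' ∘ (g ∘ f)   ≡⟨ cong (g' ∘_) e ⟩
    g' ∘ (g ∘ h)   ≡⟨ sym assoc ⟩
    (g' ∘ g) ∘ h   ≡⟨ cong (_∘ h) inv ⟩
    id ∘ h         ≡⟨ identityˡ ⟩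
    h              ∎

  inverse-unique : ∀ {A B} {f : Hom A B} {g h : Hom B A} → f ∘ g ≡ id → h ∘ f ≡ id → g ≡ h
  inverse-unique {f = f} {g} {h} fg hf = begin
    g              ≡⟨ sym identityˡ ⟩
    id ∘ g         ≡⟨ cong (_∘ g) (sym hf) ⟩
    (h ∘ f) ∘ g    ≡⟨ assoc ⟩
    h ∘ (f ∘ g)    ≡⟨ cong (h ∘_) fg ⟩
    h ∘ id         ≡⟨ identityʳ ⟩
    h              ∎

  unit⊗-injective : ∀ {X Y} {f g : Hom X Y} → id {unit} ⊗₁ f ≡ id ⊗₁ g → f ≡ g
  unit⊗-injective {f = f} {g} e = cancelʳ λ-iso₁ (begin
    f ∘ λ⇒            ≡⟨ sym λ-natural ⟩
    λ⇒ ∘ (id ⊗₁ f)    ≡⟨ cong (λ⇒ ∘_) e ⟩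
    λ⇒ ∘ (id ⊗₁ g)    ≡⟨ λ-natural ⟩
    g ∘ λ⇒            ∎)

  ⊗unit-injective : ∀ {X Y} {f g : Hom X Y} → f ⊗₁ id {unit} ≡ g ⊗₁ id → f ≡ g
  ⊗unit-injective {f = f} {g} e = cancelʳ ρ-iso₁ (begin
    f ∘ ρ⇒            ≡⟨ sym ρ-natural ⟩
    ρ⇒ ∘ (f ⊗₁ id)    ≡⟨ cong (ρ⇒ ∘_) e ⟩
    ρ⇒ ∘ (g ⊗₁ id)    ≡⟨ ρ-natural ⟩
    g ∘ ρ⇒            ∎)

  α⇒∘α⇒⊗id-iso : ∀ {W X Y Z} →
                 (α⇒ {W} {X ⊗₀ Y} {Z} ∘ (α⇒ ⊗₁ id)) ∘ ((α⇐ ⊗₁ id) ∘ α⇐) ≡ id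
  α⇒∘α⇒⊗id-iso = begin
    (α⇒ ∘ (α⇒ ⊗₁ id)) ∘ ((α⇐ ⊗₁ id) ∘ α⇐)   ≡⟨ assoc ⟩
    α⇒ ∘ ((α⇒ ⊗₁ id) ∘ ((α⇐ ⊗₁ id) ∘ α⇐))   ≡⟨ cong (α⇒ ∘_) (sym assoc) ⟩
    α⇒ ∘ (((α⇒ ⊗₁ id) ∘ (α⇐ ⊗₁ id)) ∘ α⇐)   ≡⟨ cong (λ z → α⇒ ∘ (z ∘ α⇐)) (sym ⊗-∘) ⟩
    α⇒ ∘ (((α⇒ ∘ α⇐) ⊗₁ (id ∘ id)) ∘ α⇐)    ≡⟨ cong₂ (λ a b → α⇒ ∘ ((a ⊗₁ b) ∘ α⇐)) α-iso₁ identityˡ ⟩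
    α⇒ ∘ ((id ⊗₁ id) ∘ α⇐)                   ≡⟨ cong (λ z → α⇒ ∘ (z ∘ α⇐)) ⊗-id ⟩
    α⇒ ∘ (id ∘ α⇐)                           ≡⟨ cong (α⇒ ∘_) identityˡ ⟩
    α⇒ ∘ α⇐                                  ≡⟨ α-iso₁ ⟩
    id                                       ∎

  -- Kelly's lemma: tensor with I on the left, then pentagon, triangle and naturality of α.
  λ⇒∘α⇒ : ∀ {X Y} → λ⇒ {X ⊗₀ Y} ∘ α⇒ {unit} {X} {Y} ≡ λ⇒ {X} ⊗₁ id {Y}
  λ⇒∘α⇒ = unit⊗-injective (cancelʳ α⇒∘α⇒⊗id-iso (begin
    (id ⊗₁ (λ⇒ ∘ α⇒)) ∘ (α⇒ ∘ (α⇒ ⊗₁ id))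
      ≡⟨ cong (λ z → (z ⊗₁ (λ⇒ ∘ α⇒)) ∘ (α⇒ ∘ (α⇒ ⊗₁ id))) (sym identityˡ) ⟩
    ((id ∘ id) ⊗₁ (λ⇒ ∘ α⇒)) ∘ (α⇒ ∘ (α⇒ ⊗₁ id))
      ≡⟨ cong (_∘ (α⇒ ∘ (α⇒ ⊗₁ id))) ⊗-∘ ⟩
    ((id ⊗₁ λ⇒) ∘ (id ⊗₁ α⇒)) ∘ (α⇒ ∘ (α⇒ ⊗₁ id))
      ≡⟨ assoc ⟩
    (id ⊗₁ λ⇒) ∘ ((id ⊗₁ α⇒) ∘ (α⇒ ∘ (α⇒ ⊗₁ id)))
      ≡⟨ cong ((id ⊗₁ λ⇒) ∘_) (sym pentagon) ⟩
    (id ⊗₁ λ⇒) ∘ (α⇒ ∘ α⇒)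
      ≡⟨ sym assoc ⟩
    ((id ⊗₁ λ⇒) ∘ α⇒) ∘ α⇒
      ≡⟨ cong (_∘ α⇒) triangle ⟩
    (ρ⇒ ⊗₁ id) ∘ α⇒
      ≡⟨ cong (λ z → (ρ⇒ ⊗₁ z) ∘ α⇒) (sym ⊗-id) ⟩
    (ρ⇒ ⊗₁ (id ⊗₁ id)) ∘ α⇒
      ≡⟨ sym α-natural ⟩
    α⇒ ∘ ((ρ⇒ ⊗₁ id) ⊗₁ id)
      ≡⟨ cong (λ z → α⇒ ∘ (z ⊗₁ id)) (sym triangle) ⟩
    α⇒ ∘ (((id ⊗₁ λ⇒) ∘ α⇒) ⊗₁ id)
      ≡⟨ cong (λ z → α⇒ ∘ (((id ⊗₁ λ⇒) ∘ α⇒) ⊗₁ z)) (sym identityˡ) ⟩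
    α⇒ ∘ (((id ⊗₁ λ⇒) ∘ α⇒) ⊗₁ (id ∘ id))
      ≡⟨ cong (α⇒ ∘_) ⊗-∘ ⟩
    α⇒ ∘ (((id ⊗₁ λ⇒) ⊗₁ id) ∘ (α⇒ ⊗₁ id))
      ≡⟨ sym assoc ⟩
    (α⇒ ∘ ((id ⊗₁ λ⇒) ⊗₁ id)) ∘ (α⇒ ⊗₁ id)
      ≡⟨ cong (_∘ (α⇒ ⊗₁ id)) α-natural ⟩
    ((id ⊗₁ (λ⇒ ⊗₁ id)) ∘ α⇒) ∘ (α⇒ ⊗₁ id)
      ≡⟨ assoc ⟩
    (id ⊗₁ (λ⇒ ⊗₁ id)) ∘ (α⇒ ∘ (α⇒ ⊗₁ id))
      ∎))

  λ⇒≡id⊗λ⇒ : λ⇒ {unit ⊗₀ unit} ≡ id ⊗₁ λ⇒ {unit}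
  λ⇒≡id⊗λ⇒ = cancelˡ λ-iso₂ (sym λ-natural)

  ρ⇒≡λ⇒ : ρ⇒ {unit} ≡ λ⇒ {unit}
  ρ⇒≡λ⇒ = ⊗unit-injective (begin
    ρ⇒ ⊗₁ id              ≡⟨ sym triangle ⟩
    (id ⊗₁ λ⇒) ∘ α⇒       ≡⟨ cong (_∘ α⇒) (sym λ⇒≡id⊗λ⇒) ⟩
    λ⇒ ∘ α⇒               ≡⟨ λ⇒∘α⇒ ⟩
    λ⇒ ⊗₁ id              ∎)

  ρ⇐≡λ⇐ : ρ⇐ {unit} ≡ λ⇐
  ρ⇐≡λ⇐ = inverse-unique (subst (λ f → f ∘ ρ⇐ ≡ id) ρ⇒≡λ⇒ ρ-iso₁) λ-iso₂

  ρ⇐-natural : ∀ {X Y} {f : Hom X Y} → (f ⊗₁ id) ∘ ρ⇐ ≡ ρ⇐ ∘ f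
  ρ⇐-natural {f = f} = cancelˡ ρ-iso₂ (begin
    ρ⇒ ∘ ((f ⊗₁ id) ∘ ρ⇐)   ≡⟨ sym assoc ⟩
    (ρ⇒ ∘ (f ⊗₁ id)) ∘ ρ⇐   ≡⟨ cong (_∘ ρ⇐) ρ-natural ⟩
    (f ∘ ρ⇒) ∘ ρ⇐           ≡⟨ assoc ⟩
    f ∘ (ρ⇒ ∘ ρ⇐)           ≡⟨ cong (f ∘_) ρ-iso₁ ⟩
    f ∘ id                  ≡⟨ identityʳ ⟩
    f                       ≡⟨ sym identityˡ ⟩
    id ∘ f                  ≡⟨ cong (_∘ f) (sym ρ-iso₁) ⟩
    (ρ⇒ ∘ ρ⇐) ∘ f           ≡⟨ assoc ⟩
    ρ⇒ ∘ (ρ⇐ ∘ f)           ∎)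

  ρ⇒-slide : ∀ {X Y Z} {f : Hom X Y} {u : Hom Z (X ⊗₀ unit)} →
             ρ⇒ ∘ ((f ⊗₁ id) ∘ u) ≡ f ∘ (ρ⇒ ∘ u)
  ρ⇒-slide {f = f} {u} = begin
    ρ⇒ ∘ ((f ⊗₁ id) ∘ u)   ≡⟨ sym assoc ⟩
    (ρ⇒ ∘ (f ⊗₁ id)) ∘ u   ≡⟨ cong (_∘ u) ρ-natural ⟩
    (f ∘ ρ⇒) ∘ u           ≡⟨ assoc ⟩
    f ∘ (ρ⇒ ∘ u)           ∎

  ρ⇒∘⊗∘λ⇐ : ∀ {X} (a : Hom unit X) (v : Hom unit unit) → ρ⇒ ∘ ((a ⊗₁ v) ∘ λ⇐) ≡ a ∘ v
  ρ⇒∘⊗∘λ⇐ a v = begin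
    ρ⇒ ∘ ((a ⊗₁ v) ∘ λ⇐)
      ≡⟨ cong₂ (λ x y → ρ⇒ ∘ ((x ⊗₁ y) ∘ λ⇐)) (sym identityʳ) (sym identityˡ) ⟩
    ρ⇒ ∘ (((a ∘ id) ⊗₁ (id ∘ v)) ∘ λ⇐)
      ≡⟨ cong (λ z → ρ⇒ ∘ (z ∘ λ⇐)) ⊗-∘ ⟩
    ρ⇒ ∘ (((a ⊗₁ id) ∘ (id ⊗₁ v)) ∘ λ⇐)
      ≡⟨ cong (ρ⇒ ∘_) assoc ⟩
    ρ⇒ ∘ ((a ⊗₁ id) ∘ ((id ⊗₁ v) ∘ λ⇐))
      ≡⟨ ρ⇒-slide ⟩
    a ∘ (ρ⇒ ∘ ((id ⊗₁ v) ∘ λ⇐))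
      ≡⟨ cong (λ z → a ∘ (z ∘ ((id ⊗₁ v) ∘ λ⇐))) ρ⇒≡λ⇒ ⟩
    a ∘ (λ⇒ ∘ ((id ⊗₁ v) ∘ λ⇐))
      ≡⟨ cong (a ∘_) (sym assoc) ⟩
    a ∘ ((λ⇒ ∘ (id ⊗₁ v)) ∘ λ⇐)
      ≡⟨ cong (λ z → a ∘ (z ∘ λ⇐)) λ-natural ⟩
    a ∘ ((v ∘ λ⇒) ∘ λ⇐)
      ≡⟨ cong (a ∘_) assoc ⟩
    a ∘ (v ∘ (λ⇒ ∘ λ⇐))
      ≡⟨ cong (λ z → a ∘ (v ∘ z)) λ-iso₁ ⟩
    a ∘ (v ∘ id)
      ≡⟨ cong (a ∘_) identityʳ ⟩
    a ∘ v
      ∎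

  ⊗id∘λ⇐ : ∀ {X} (w : Hom unit X) → (w ⊗₁ id) ∘ λ⇐ ≡ ρ⇐ ∘ w
  ⊗id∘λ⇐ w = trans (cong ((w ⊗₁ id) ∘_) (sym ρ⇐≡λ⇐)) ρ⇐-natural

module Orthogonality {o ℓ} (𝒞 : Category o ℓ) (M : SymmetricMonoidal 𝒞)
    (P : FiniteProducts 𝒞) (E : FreeExponential 𝒞 M P)
    (J : Category.Obj 𝒞) (O : ReciprocalOrthogonality 𝒞 M P J) where
  open Category 𝒞
  open SymmetricMonoidal M
  open Theory 𝒞 M P E O
  open MonoidalCoherence 𝒞 M

  _⊆_ : ∀ {A} → Points A → Points A → Set ℓ
  U ⊆ V = ∀ u → U u → V u

  ⊆-°° : ∀ {A} {U : Points A} → U ⊆ (U °°)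
  ⊆-°° u Uu x xU = xU u Uu

  °°-idempotent : ∀ {A} (W : Points A) → ((W °°) °°) ≐ (W °°)
  °°-idempotent W u = (λ h x xW → h x (λ w wW → wW x xW)) , ⊆-°° u

  IsTMor-°° : ∀ {A B} {U : Points A} {W : Points B} {f : Hom A B} →
              IsTMor U (W °°) f → IsTMor (U °°) (W °°) f
  IsTMor-°° {f = f} m u uU x xW =
    proj₁ (reciprocal u f x) (uU (x ∘ f) λ u' u'U → proj₂ (reciprocal u' f x) (m u' u'U x xW))

  unitT : TObj
  unitT = record { car = unit ; pts = unitP ; closed = °°-idempotent (λ u → u ≡ id) }

  point-IsTMor : ∀ {A} {W : Points A} {v : Hom unit A} → (W °°) v → IsTMor unitP (W °°) v
  point-IsTMor {W = W} {v} vW = IsTMor-°° λ w w≡id →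
    subst (λ z → (W °°) (v ∘ z)) (sym w≡id) (subst (W °°) (sym identityʳ) vW)

  ⋂preimage : ∀ {D : ℕ → Obj} {L} → (∀ n → Points (D n)) → (∀ n → Hom L (D n)) → Points L
  ⋂preimage DP π u = ∀ n → DP n (π n ∘ u)

  ⋂preimage-closed : ∀ {D : ℕ → Obj} {L} (W : ∀ n → Points (D n)) (π : ∀ n → Hom L (D n)) →
                     (⋂preimage (λ n → W n °°) π °°) ⊆ ⋂preimage (λ n → W n °°) π
  ⋂preimage-closed W π u h n = IsTMor-°° (λ x x∈⋂ → x∈⋂ n) u h

  tensorP-unit : ∀ {X} (W : Points X) (u : Hom unit (X ⊗₀ unit)) →
                 tensorP (W °°) unitP u ⟺ (W °°) (ρ⇒ ∘ u)
  tensorP-unit W u = IsTMor-°° ρ⇒-generators u , from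
    where
      ρ⇒-generators : IsTMor ((W °°) ⊗ₛ unitP) (W °°) ρ⇒
      ρ⇒-generators w (a , v , a∈W , v∈I , w≡) =
        subst (W °°) (sym (trans (cong (ρ⇒ ∘_) w≡) (ρ⇒∘⊗∘λ⇐ a v))) (point-IsTMor a∈W v v∈I)

      ρ⇒u⊗ₚid≡u : ((ρ⇒ ∘ u) ⊗₁ id) ∘ λ⇐ ≡ u
      ρ⇒u⊗ₚid≡u = begin
        ((ρ⇒ ∘ u) ⊗₁ id) ∘ λ⇐   ≡⟨ ⊗id∘λ⇐ (ρ⇒ ∘ u) ⟩
        ρ⇐ ∘ (ρ⇒ ∘ u)           ≡⟨ sym assoc ⟩
        (ρ⇐ ∘ ρ⇒) ∘ u           ≡⟨ cong (_∘ u) ρ-iso₂ ⟩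
        id ∘ u                  ≡⟨ identityˡ ⟩
        u                       ∎
        where open ≡-Reasoning

      from : (W °°) (ρ⇒ ∘ u) → tensorP (W °°) unitP u
      from h = ⊆-°° u (ρ⇒ ∘ u , id , h , ⊆-°° id refl , sym ρ⇒u⊗ₚid≡u)

  IsTChainLimit⟺⋂preimage : (D : ℕ → Obj) (W : ∀ n → Points (D n)) (d : ∀ n → Hom (D (suc n)) (D n))
                            {L : Obj} (LP : Points L) (π : ∀ n → Hom L (D n)) →
                            IsChainLimit 𝒞 D d π →
                            IsTChainLimit D (λ n → W n °°) d LP π
                            ⟺ (LP ≐ ⋂preimage (λ n → W n °°) π)
  IsTChainLimit⟺⋂preimage D W d LP π lim = to , from
    where
      module Lim = IsChainLimit lim

      to : IsTChainLimit D (λ n → W n °°) d LP π → LP ≐ ⋂preimage (λ n → W n °°) π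
      to T u = (λ u∈LP n → π-mor n u u∈LP) , ⋂preimage⊆LP
        where
          open IsTChainLimit T

          -- u is the mediating map of the cone (π n ∘ u)ₙ out of 𝐈, which lies in T_J.
          ⋂preimage⊆LP : ⋂preimage (λ n → W n °°) π u → LP u
          ⋂preimage⊆LP u∈⋂ =
            let (k , k-mor , πk≡πu , _) =
                  universal unitT (λ n → π n ∘ u) (λ n → point-IsTMor (u∈⋂ n)) cone-u
                (_ , _ , unique) = Lim.universal (λ n → π n ∘ u) cone-u
                k≡u = trans (unique k πk≡πu) (sym (unique u λ n → refl))
            in subst LP (trans identityʳ k≡u) (k-mor id (⊆-°° id refl))
            where
              cone-u : ∀ n → d n ∘ (π (suc n) ∘ u) ≡ π n ∘ u
              cone-u n = trans (sym assoc) (cong (_∘ u) (Lim.cone n))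

      from : LP ≐ ⋂preimage (λ n → W n °°) π → IsTChainLimit D (λ n → W n °°) d LP π
      from LP≐⋂ = record
        { π-mor = λ n u u∈LP → proj₁ (LP≐⋂ u) u∈LP n
        ; cone = Lim.cone
        ; universal = λ Z c c-mor c-cone →
            let (k , πk≡c , k-unique) = Lim.universal c c-cone
            in k
             , (λ z z∈Z → proj₂ (LP≐⋂ (k ∘ z)) λ n →
                  subst (W n °°) (trans (cong (_∘ z) (sym (πk≡c n))) assoc) (c-mor n z z∈Z))
             , πk≡c
             , (λ k' _ πk'≡c → k-unique k' πk'≡c)
        }

  tensorP-unit-⋂preimage : ∀ {D : ℕ → Obj} {L} (W : ∀ n → Points (D n)) (π : ∀ n → Hom L (D n)) →
                           tensorP (⋂preimage (λ n → W n °°) π °°) unitP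
                           ≐ ⋂preimage (λ n → tensorP (W n °°) unitP) (λ n → π n ⊗₁ id)
  tensorP-unit-⋂preimage W π u = to , from
    where
      to : tensorP (⋂preimage (λ n → W n °°) π °°) unitP u →
           ⋂preimage (λ n → tensorP (W n °°) unitP) (λ n → π n ⊗₁ id) u
      to h n = proj₂ (tensorP-unit (W n) _) (subst (W n °°) (sym ρ⇒-slide)
                 (⋂preimage-closed W π (ρ⇒ ∘ u) (proj₁ (tensorP-unit _ u) h) n))

      from : ⋂preimage (λ n → tensorP (W n °°) unitP) (λ n → π n ⊗₁ id) u →
             tensorP (⋂preimage (λ n → W n °°) π °°) unitP u
      from h = proj₂ (tensorP-unit _ u) (⊆-°° (ρ⇒ ∘ u) λ n →
                 subst (W n °°) ρ⇒-slide (proj₁ (tensorP-unit (W n) _) (h n)))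

mainTheorem14 : ∀ {o ℓ} (𝒞 : Category o ℓ) (M : SymmetricMonoidal 𝒞)
                  (P : FiniteProducts 𝒞) (E : FreeExponential 𝒞 M P)
                  (J : Category.Obj 𝒞) (O : ReciprocalOrthogonality 𝒞 M P J) →
                  let open Category 𝒞
                      open SymmetricMonoidal M
                      open Theory 𝒞 M P E O
                  in (∀ (𝐀 𝐁 : TObj) →
                        IsTChainLimit (λ n → Exp (car 𝐀) n ⊗₀ car 𝐁)
                                      (λ n → tensorP (ExpP 𝐀 n) (pts 𝐁))
                                      (λ n → p (car 𝐀) n ⊗₁ id {car 𝐁})
                                      (tensorP (Exp∞P 𝐀) (pts 𝐁))
                                      (λ n → p∞ (car 𝐀) n ⊗₁ id {car 𝐁})
                        ⟺ (tensorP (Exp∞P 𝐀) (pts 𝐁)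
                            ≐ (λ u → ∀ (n : ℕ) → tensorP (ExpP 𝐀 n) (pts 𝐁)
                                                   ((p∞ (car 𝐀) n ⊗₁ id {car 𝐁}) ∘ u))))
                     × (∀ (𝐀 : TObj) →
                          tensorP (Exp∞P 𝐀) unitP
                          ≐ (λ u → ∀ (n : ℕ) → tensorP (ExpP 𝐀 n) unitP
                                                 ((p∞ (car 𝐀) n ⊗₁ id {unit}) ∘ u)))
mainTheorem14 𝒞 M P E J O =
    (λ 𝐀 𝐁 → IsTChainLimit⟺⋂preimage _ (λ n → ExpP 𝐀 n ⊗ₛ pts 𝐁) _ _ _ (limit-⊗ (car 𝐀) (car 𝐁)))
  , (λ 𝐀 → tensorP-unit-⋂preimage _ (p∞ (car 𝐀)))
  where
    open Theory 𝒞 M P E O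
    open Orthogonality 𝒞 M P E J O
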